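{- There exist infinitely many distinct logics that extend fundamental logic and are contained both in orthologic and in the implication-free fragment of intuitionistic logic.
   Context: Formulas use variables, $\top,\bot,\wedge,\vee,\lnot$ (no implication). A fundamental lattice is a bounded lattice with unary $\lnot$ that is antitone, satisfies $a\wedge\lnot a=0$ and $a\le\lnot\lnot a$; an entailment $\varphi\vdash\psi$ is valid in $L$ if $v(\varphi)\le v(\psi)$ for all valuations. Fundamental logic is the set of entailments valid in all fundamental lattices; a logic extending fundamental logic is, for some set $\Gamma$ of entailments, the set of entailments valid in every fundamental lattice validating $\Gamma$. Orthologic is the set of entailments valid in all ortholattices (fundamental lattices with $\lnot\lnot a=a$); the implication-free fragment of intuitionistic logic is the set valid in all Heyting lattices (distributive fundamental lattices with $a\wedge b=0\Rightarrow b\le\lnot a$). -}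

module Defs where

open import Data.Nat using (ℕ)
open import Data.Product using (_×_; _,_)
open import Relation.Nullary using (¬_)
open import Relation.Binary.Lattice.Bundles using (BoundedLattice)
open import Level using (0ℓ)

data Formula : Set where
  var  : ℕ → Formula
  `⊤   : Formula
  `⊥   : Formula
  _`∧_ : Formula → Formula → Formula
  _`∨_ : Formula → Formula → Formula
  `¬_  : Formula → Formula

record Entailment : Set where
  constructor _⊢_
  field
    lhs : Formula
    rhs : Formula

record FundamentalLattice : Set₁ where
  field
    boundedLattice : BoundedLattice 0ℓ 0ℓ 0ℓ
  open BoundedLattice boundedLattice public hiding (lattice)
  field
    neg      : Carrier → Carrier
    antitone : ∀ {a b} → a ≤ b → neg b ≤ neg a
    a∧¬a≈⊥   : ∀ a → (a ∧ neg a) ≈ ⊥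
    a≤¬¬a    : ∀ a → a ≤ neg (neg a)

module _ (L : FundamentalLattice) where
  open FundamentalLattice L

  Valuation : Set
  Valuation = ℕ → Carrier

  ⟦_⟧ : Formula → Valuation → Carrier
  ⟦ var n ⟧   v = v n
  ⟦ `⊤ ⟧      v = ⊤
  ⟦ `⊥ ⟧      v = ⊥
  ⟦ φ `∧ ψ ⟧  v = ⟦ φ ⟧ v ∧ ⟦ ψ ⟧ v
  ⟦ φ `∨ ψ ⟧  v = ⟦ φ ⟧ v ∨ ⟦ ψ ⟧ v
  ⟦ `¬ φ ⟧    v = neg (⟦ φ ⟧ v)

  ValidIn : Entailment → Set
  ValidIn (φ ⊢ ψ) = ∀ (v : Valuation) → ⟦ φ ⟧ v ≤ ⟦ ψ ⟧ v

  Validates : (Entailment → Set) → Set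
  Validates Γ = ∀ e → Γ e → ValidIn e

  IsOrtholattice : Set
  IsOrtholattice = ∀ a → neg (neg a) ≈ a

  IsHeytingLattice : Set
  IsHeytingLattice =
    (∀ a b c → (a ∧ (b ∨ c)) ≈ ((a ∧ b) ∨ (a ∧ c)))
    × (∀ a b → (a ∧ b) ≈ ⊥ → b ≤ neg a)

EntSet : Set₂
EntSet = Entailment → Set₁

-- The logic extending fundamental logic axiomatized by Γ:
-- entailments valid in every fundamental lattice validating Γ.
LogicOf : (Entailment → Set) → EntSet
LogicOf Γ e = ∀ (L : FundamentalLattice) → Validates L Γ → ValidIn L e

Orthologic : EntSet
Orthologic e = ∀ (L : FundamentalLattice) → IsOrtholattice L → ValidIn L e

IntFragment : EntSet
IntFragment e = ∀ (L : FundamentalLattice) → IsHeytingLattice L → ValidIn L e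

_⊆_ : EntSet → EntSet → Set₁
A ⊆ B = ∀ e → A e → B e

_≐_ : EntSet → EntSet → Set₁
A ≐ B = A ⊆ B × B ⊆ A

-- Let pigeonhole n be the entailment ⋀_{i<n} ¬¬pᵢ ⊢ ⋁_{b<n} (p_b ∨ ⋁_{a<b} ¬¬(pₐ ∧ p_b)).
-- It holds in every ortholattice (¬¬p_{n-1} = p_{n-1}) and, for n ≥ 2, in every
-- pseudocomplemented lattice, where ¬¬p₀ ∧ ¬¬p₁ ≤ ¬¬(p₀ ∧ p₁).  On the powerset of a
-- k-element set, let ¬a be ∅ for a ≠ ∅ and everything for a = ∅: there pigeonhole m
-- holds whenever k < m, as m nonempty sets must meet, but pigeonhole n fails for
-- k = n + 1, taking pairwise disjoint singletons pᵢ that miss one point.  So for i < j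
-- the powerset of a (3 + 2i)-element set validates pigeonhole (2 + 2j) but not
-- pigeonhole (2 + 2i), separating the logics these two entailments axiomatise.
module Submission where

open import Defs
open import Data.Nat using (ℕ)
open import Data.Product using (Σ; _×_)
open import Relation.Binary.PropositionalEquality using (_≡_)
open import Relation.Nullary using (¬_)

open import Data.Bool using (Bool; T)
open import Data.Bool.Properties using (T-≡)
open import Data.Empty using (⊥-elim)
open import Data.Fin as Fin using (Fin; toℕ; fromℕ<)
open import Data.Fin.Properties using (toℕ<n; toℕ-fromℕ<; pigeonhole)
open import Data.Fin.Subset as Subset using (Subset; _∈_; _∩_; _∪_; ∁; ⁅_⁆; Nonempty; Empty)
open import Data.Fin.Subset.Properties
  using ( ⊆-isPartialOrder; ⊆-max; ⊆-min; p⊆p∪q; q⊆p∪q; x∈p∪q⁻; p∩q⊆p; p∩q⊆q; x∈p∩q⁺; x∈p∩q⁻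
        ; nonempty?; Empty-unique; ∉⊥; ∈⊤; x∈⁅x⁆; x∈⁅y⁆⇒x≡y; x∉p⇒x∈∁p; x∈p⇒x∉∁p)
open import Data.Nat using (zero; suc; _+_; _<_; _≡ᵇ_; s≤s)
open import Data.Nat.Properties
  using ( m<1+n⇒m<n∨m≡n; m<n⇒m<1+n; n<1+n; +-suc; +-mono-≤; <-cmp; <-irrefl
        ; suc-injective; 0≢1+n; ≡ᵇ⇒≡; ≡⇒≡ᵇ)
open import Data.Product using (_,_; proj₁; proj₂)
open import Data.Sum using (inj₁; inj₂; [_,_])
open import Data.Vec using (tabulate)
open import Data.Vec.Properties using (lookup∘tabulate; lookup⇒[]=; []=⇒lookup)
open import Function using (_∘_; Equivalence)
open import Level using (0ℓ)
open import Relation.Binary.Definitions using (tri<; tri≈; tri>)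
open import Relation.Binary.Lattice.Bundles using (BoundedLattice)
open import Relation.Binary.PropositionalEquality as ≡ using (refl; sym; cong; subst)
open import Relation.Nullary using (yes; no)
open import Relation.Nullary.Decidable using (decidable-stable)

⋀ : ℕ → (ℕ → Formula) → Formula
⋀ zero    f = `⊤
⋀ (suc n) f = ⋀ n f `∧ f n

⋁ : ℕ → (ℕ → Formula) → Formula
⋁ zero    f = `⊥
⋁ (suc n) f = ⋁ n f `∨ f n

allInhabited : ℕ → Formula
allInhabited n = ⋀ n (λ i → `¬ `¬ var i)

overlapBelow : ℕ → Formula
overlapBelow b = ⋁ b (λ a → `¬ `¬ (var a `∧ var b))

someVarOrOverlap : ℕ → Formula
someVarOrOverlap n = ⋁ n (λ b → var b `∨ overlapBelow b)

pigeonholeEntailment : ℕ → Entailment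
pigeonholeEntailment n = allInhabited n ⊢ someVarOrOverlap n

module Bounds (L : FundamentalLattice) (v : Valuation L) where
  open FundamentalLattice L hiding (refl)

  private
    ⟪_⟫ : Formula → Carrier
    ⟪ φ ⟫ = ⟦_⟧ L φ v

  ⋀-lower : ∀ f {i n} → i < n → ⟪ ⋀ n f ⟫ ≤ ⟪ f i ⟫
  ⋀-lower f {n = suc n} i<1+n with m<1+n⇒m<n∨m≡n i<1+n
  ... | inj₁ i<n  = trans (x∧y≤x _ _) (⋀-lower f i<n)
  ... | inj₂ refl = x∧y≤y _ _

  ⋀-greatest : ∀ f n {x} → (∀ {i} → i < n → x ≤ ⟪ f i ⟫) → x ≤ ⟪ ⋀ n f ⟫
  ⋀-greatest f zero    _ = maximum _
  ⋀-greatest f (suc n) h = ∧-greatest (⋀-greatest f n (h ∘ m<n⇒m<1+n)) (h (n<1+n n))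

  ⋁-upper : ∀ f {i n} → i < n → ⟪ f i ⟫ ≤ ⟪ ⋁ n f ⟫
  ⋁-upper f {n = suc n} i<1+n with m<1+n⇒m<n∨m≡n i<1+n
  ... | inj₁ i<n  = trans (⋁-upper f i<n) (x≤x∨y _ _)
  ... | inj₂ refl = y≤x∨y _ _

  ⋁-least : ∀ f n {x} → (∀ {i} → i < n → ⟪ f i ⟫ ≤ x) → ⟪ ⋁ n f ⟫ ≤ x
  ⋁-least f zero    _ = minimum _
  ⋁-least f (suc n) h = ∨-least (⋁-least f n (h ∘ m<n⇒m<1+n)) (h (n<1+n n))

  var≤someVarOrOverlap : ∀ {b n} → b < n → v b ≤ ⟪ someVarOrOverlap n ⟫
  var≤someVarOrOverlap b<n = trans (x≤x∨y _ _) (⋁-upper _ b<n)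

  overlap≤someVarOrOverlap : ∀ {a b n} → a < b → b < n →
                             neg (neg (v a ∧ v b)) ≤ ⟪ someVarOrOverlap n ⟫
  overlap≤someVarOrOverlap a<b b<n =
    trans (⋁-upper _ a<b) (trans (y≤x∨y _ _) (⋁-upper _ b<n))

module _ (L : FundamentalLattice) where
  open FundamentalLattice L hiding (refl)

  ≤-contradiction : ∀ {x a} → x ≤ a → x ≤ neg a → x ≤ ⊥
  ≤-contradiction x≤a x≤¬a = trans (∧-greatest x≤a x≤¬a) (reflexive (a∧¬a≈⊥ _))

  pigeonhole-valid-ortho : IsOrtholattice L → ∀ m → ValidIn L (pigeonholeEntailment (suc m))
  pigeonhole-valid-ortho ¬¬a≈a m v =
    trans (⋀-lower _ (n<1+n m))
      (trans (reflexive (¬¬a≈a (v m))) (var≤someVarOrOverlap (n<1+n m)))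
    where open Bounds L v

  module Pseudocomplemented (pseudocomplement : ∀ a b → (a ∧ b) ≈ ⊥ → b ≤ neg a) where

    neg-intro : ∀ {x a} → (∀ {y} → y ≤ x → y ≤ a → y ≤ ⊥) → x ≤ neg a
    neg-intro h = pseudocomplement _ _ (antisym (h (x∧y≤y _ _) (x∧y≤x _ _)) (minimum _))

    -- The intuitionistic proof of ¬¬a ∧ ¬¬b → ¬¬(a ∧ b), with each ¬-introduction
    -- read through neg-intro.
    ¬¬-∧ : ∀ a b → (neg (neg a) ∧ neg (neg b)) ≤ neg (neg (a ∧ b))
    ¬¬-∧ a b = neg-intro λ y≤ y≤¬ab →
      ≤-contradiction (neg-intro λ z≤y z≤a →
        ≤-contradiction (neg-intro λ u≤z u≤b →
            ≤-contradiction (∧-greatest (trans u≤z z≤a) u≤b) (trans u≤z (trans z≤y y≤¬ab)))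
          (trans z≤y (trans y≤ (x∧y≤y _ _))))
        (trans y≤ (x∧y≤x _ _))

    pigeonhole-valid : ∀ m → ValidIn L (pigeonholeEntailment (2 + m))
    pigeonhole-valid m v =
      trans (∧-greatest (⋀-lower _ m<2+m) (⋀-lower _ (n<1+n (suc m))))
        (trans (¬¬-∧ (v m) (v (suc m))) (overlap≤someVarOrOverlap (n<1+n m) (n<1+n (suc m))))
      where
      open Bounds L v
      m<2+m = m<n⇒m<1+n (n<1+n m)

⊆-boundedLattice : ℕ → BoundedLattice 0ℓ 0ℓ 0ℓ
⊆-boundedLattice k = record
  { Carrier = Subset k ; _≈_ = _≡_ ; _≤_ = Subset._⊆_ ; _∨_ = _∪_ ; _∧_ = _∩_
  ; ⊤ = Subset.⊤ ; ⊥ = Subset.⊥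
  ; isBoundedLattice = record
    { isLattice = record
      { isPartialOrder = ⊆-isPartialOrder k
      ; supremum = λ p q → p⊆p∪q q , q⊆p∪q p q , λ r p⊆r q⊆r → [ p⊆r , q⊆r ] ∘ x∈p∪q⁻ p q
      ; infimum  = λ p q → p∩q⊆p p q , p∩q⊆q p q , λ r r⊆p r⊆q x∈r → x∈p∩q⁺ (r⊆p x∈r , r⊆q x∈r)
      }
    ; maximum = ⊆-max
    ; minimum = ⊆-min
    }
  }

module TrivialNegation (k : ℕ) where

  neg : Subset k → Subset k
  neg p with nonempty? p
  ... | yes _ = Subset.⊥
  ... | no _  = Subset.⊤

  ∈-neg⁺ : ∀ {p x} → Empty p → x ∈ neg p
  ∈-neg⁺ {p} p-empty with nonempty? p
  ... | yes p-nonempty = ⊥-elim (p-empty p-nonempty)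
  ... | no _           = ∈⊤

  ∈-neg⁻ : ∀ {p x} → x ∈ neg p → Empty p
  ∈-neg⁻ {p} x∈ p-nonempty with nonempty? p
  ... | yes _ = ∉⊥ x∈
  ... | no p-empty = p-empty p-nonempty

  ∈-¬¬⁺ : ∀ {p x} → Nonempty p → x ∈ neg (neg p)
  ∈-¬¬⁺ p-nonempty = ∈-neg⁺ λ (_ , y∈) → ∈-neg⁻ y∈ p-nonempty

  ∈-¬¬⁻ : ∀ {p x} → x ∈ neg (neg p) → Nonempty p
  ∈-¬¬⁻ {p} {x} x∈ = decidable-stable (nonempty? p) λ p-empty → ∈-neg⁻ x∈ (x , ∈-neg⁺ p-empty)

  lattice : FundamentalLattice
  lattice = record
    { boundedLattice = ⊆-boundedLattice k
    ; neg            = neg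
    ; antitone       = λ p⊆q x∈ → ∈-neg⁺ λ (_ , y∈p) → ∈-neg⁻ x∈ (_ , p⊆q y∈p)
    ; a∧¬a≈⊥         = λ p → Empty-unique λ (_ , y∈) →
                         let y∈p , y∈¬p = x∈p∩q⁻ p (neg p) y∈ in ∈-neg⁻ y∈¬p (_ , y∈p)
    ; a≤¬¬a          = λ _ y∈p → ∈-¬¬⁺ (_ , y∈p)
    }

  nonempty-meet : ∀ {m} → k < m → (v : ℕ → Subset k) → (∀ {i} → i < m → Nonempty (v i)) →
                  Σ ℕ λ a → Σ ℕ λ b → a < b × b < m × Nonempty (v a ∩ v b)
  nonempty-meet {m} k<m v inhabited with pigeonhole k<m (λ i → proj₁ (inhabited (toℕ<n i)))
  ... | i , j , i<j , same-point =
    toℕ i , toℕ j , i<j , toℕ<n j , _ , x∈p∩q⁺ (proj₂ (inhabited (toℕ<n i)) , x∈vj)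
    where
    x∈vj = subst (_∈ v (toℕ j)) (sym same-point) (proj₂ (inhabited (toℕ<n j)))

  pigeonhole-valid : ∀ {m} → k < m → ValidIn lattice (pigeonholeEntailment m)
  pigeonhole-valid k<m v x∈ =
    let _ , _ , a<b , b<m , meet = nonempty-meet k<m v (λ i<m → ∈-¬¬⁻ (⋀-lower _ i<m x∈))
    in overlap≤someVarOrOverlap a<b b<m (∈-¬¬⁺ meet)
    where open Bounds lattice v

∈-tabulate⁺ : ∀ {k} (f : Fin k → Bool) {x} → T (f x) → x ∈ tabulate f
∈-tabulate⁺ f {x} fx =
  lookup⇒[]= x (tabulate f) (≡.trans (lookup∘tabulate f x) (Equivalence.to T-≡ fx))

∈-tabulate⁻ : ∀ {k} (f : Fin k → Bool) {x} → x ∈ tabulate f → T (f x)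
∈-tabulate⁻ f {x} x∈ =
  Equivalence.from T-≡ (≡.trans (sym (lookup∘tabulate f x)) ([]=⇒lookup x∈))

module PigeonholeCountermodel (n : ℕ) where
  open TrivialNegation (suc n)
  open FundamentalLattice lattice using (∨-least)

  is-suc : ℕ → Fin (suc n) → Bool
  is-suc i x = toℕ x ≡ᵇ suc i

  -- The singleton {suc i}, empty when suc i is out of range; the point 0 is never covered.
  point : ℕ → Subset (suc n)
  point i = tabulate (is-suc i)

  ∈-point⁻ : ∀ {i x} → x ∈ point i → toℕ x ≡ suc i
  ∈-point⁻ {i} {x} x∈ = ≡ᵇ⇒≡ (toℕ x) (suc i) (∈-tabulate⁻ (is-suc i) x∈)

  point-nonempty : ∀ {i} → i < n → Nonempty (point i)
  point-nonempty {i} i<n =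
    fromℕ< (s≤s i<n) , ∈-tabulate⁺ (is-suc i) (≡⇒≡ᵇ _ (suc i) (toℕ-fromℕ< (s≤s i<n)))

  point-disjoint : ∀ {a b} → a < b → Empty (point a ∩ point b)
  point-disjoint a<b (_ , x∈) =
    let x∈a , x∈b = x∈p∩q⁻ _ _ x∈
    in <-irrefl (suc-injective (≡.trans (sym (∈-point⁻ x∈a)) (∈-point⁻ x∈b))) a<b

  point⊆∁⁅0⁆ : ∀ {i} → point i Subset.⊆ ∁ ⁅ Fin.zero ⁆
  point⊆∁⁅0⁆ x∈ = x∉p⇒x∈∁p λ x∈⁅0⁆ →
    0≢1+n (≡.trans (cong toℕ (sym (x∈⁅y⁆⇒x≡y _ x∈⁅0⁆))) (∈-point⁻ x∈))

  pigeonhole-invalid : ¬ ValidIn lattice (pigeonholeEntailment n)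
  pigeonhole-invalid valid = x∈p⇒x∉∁p (x∈⁅x⁆ Fin.zero) (rhs⊆∁⁅0⁆ (valid point (lhs-full ∈⊤)))
    where
    open Bounds lattice point
    lhs-full : Subset.⊤ Subset.⊆ ⟦_⟧ lattice (allInhabited n) point
    lhs-full = ⋀-greatest _ n λ i<n _ → ∈-¬¬⁺ (point-nonempty i<n)
    rhs⊆∁⁅0⁆ : ⟦_⟧ lattice (someVarOrOverlap n) point Subset.⊆ ∁ ⁅ Fin.zero ⁆
    rhs⊆∁⁅0⁆ = ⋁-least _ n λ {b} _ → ∨-least point⊆∁⁅0⁆
      (⋁-least (λ a → `¬ `¬ (var a `∧ var b)) b λ a<b y∈ →
        ⊥-elim (point-disjoint a<b (∈-¬¬⁻ y∈)))

axiom∈LogicOf : ∀ {Γ : Entailment → Set} {e} → Γ e → LogicOf Γ e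
axiom∈LogicOf γ _ valid = valid _ γ

LogicOf-⊆-semantic : ∀ (Γ : Entailment → Set) (P : FundamentalLattice → Set) →
                     (∀ L → P L → Validates L Γ) →
                     LogicOf Γ ⊆ (λ e → ∀ L → P L → ValidIn L e)
LogicOf-⊆-semantic _ _ validates _ e∈ L pL = e∈ L (validates L pL)

validates-singleton : ∀ L {e} → ValidIn L e → Validates L (_≡ e)
validates-singleton _ valid _ refl = valid

pigeons : ℕ → ℕ
pigeons i = 2 + (i + i)

pigeons-gap : ∀ {i j} → i < j → suc (pigeons i) < pigeons j
pigeons-gap {i} {j} i<j = s≤s (s≤s (subst (_< j + j) (+-suc i i) (+-mono-≤ i<j i<j)))

Γ : ℕ → Entailment → Set
Γ i = _≡ pigeonholeEntailment (pigeons i)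

LogicOf-Γ-⊈ : ∀ {i j} → i < j → ¬ (LogicOf (Γ i) ⊆ LogicOf (Γ j))
LogicOf-Γ-⊈ {i} i<j Γi⊆Γj =
  PigeonholeCountermodel.pigeonhole-invalid (pigeons i)
    (Γi⊆Γj (pigeonholeEntailment (pigeons i)) (axiom∈LogicOf refl) countermodel
      (validates-singleton countermodel (TrivialNegation.pigeonhole-valid _ (pigeons-gap i<j))))
  where countermodel = TrivialNegation.lattice (suc (pigeons i))

theorem7p1 : Σ (ℕ → Entailment → Set) λ Γ →
    (∀ i j → ¬ i ≡ j → ¬ (LogicOf (Γ i) ≐ LogicOf (Γ j)))
    × (∀ i → (LogicOf (Γ i) ⊆ Orthologic) × (LogicOf (Γ i) ⊆ IntFragment))
theorem7p1 = Γ , distinct , λ i → ⊆Orthologic i , ⊆IntFragment i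
  where
  distinct : ∀ i j → ¬ i ≡ j → ¬ (LogicOf (Γ i) ≐ LogicOf (Γ j))
  distinct i j i≢j (Γi⊆Γj , Γj⊆Γi) with <-cmp i j
  ... | tri< i<j _ _ = LogicOf-Γ-⊈ i<j Γi⊆Γj
  ... | tri≈ _ i≡j _ = i≢j i≡j
  ... | tri> _ _ j<i = LogicOf-Γ-⊈ j<i Γj⊆Γi

  ⊆Orthologic : ∀ i → LogicOf (Γ i) ⊆ Orthologic
  ⊆Orthologic i = LogicOf-⊆-semantic (Γ i) IsOrtholattice λ L ortho →
    validates-singleton L (pigeonhole-valid-ortho L ortho (suc (i + i)))

  ⊆IntFragment : ∀ i → LogicOf (Γ i) ⊆ IntFragment
  ⊆IntFragment i = LogicOf-⊆-semantic (Γ i) IsHeytingLattice λ L (_ , pseudocomplement) →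
    validates-singleton L (Pseudocomplemented.pigeonhole-valid L pseudocomplement (i + i))
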